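{- Let $A=\{a_1,\dots,a_s\}$ and $B=\{b_1,\dots,b_t\}$ be finite point sets with $s+t=n$, real costs $\delta(a_i,b_j)$, and nonnegative integer demands and capacities $\alpha_i\le\alpha'_i$ ($1\le i\le s$), $\beta_j\le\beta'_j\le s$ ($1\le j\le t$). Let $G$ be the weighted bipartite graph constructed below, let $M$ be the set of main edges of a minimum weight perfect matching in $G$, and let $L$ be an MMDC matching between $A$ and $B$. Then $w(M)\ge c(L)$.
   Context: An MMDC matching between $A$ and $B$ is a set $L\subseteq A\times B$ of pairs such that each $a_i$ lies in at least $\alpha_i$ and at most $\alpha'_i$ pairs of $L$, each $b_j$ lies in at least $\beta_j$ and at most $\beta'_j$ pairs of $L$, and $c(L)=\sum_{(a_i,b_j)\in L}\delta(a_i,b_j)$ is minimum among all such sets. $w(M)$ is the total weight of the edges in $M$. Let $\gamma=\min_{i,j}\delta(a_i,b_j)$ and fix reals $\gamma'<\gamma''<\gamma$. Construction of $G$ with sides $S,T$: for each $i$, $S$ contains $A_i=\{a_{i1},\dots,a_{i\alpha_i}\}$ and $A'_i=\{a'_{i1},\dots,a'_{i(\alpha'_i-\alpha_i)}\}$, and $T$ contains $Bset_i=\{b_{1i},\dots,b_{ti}\}$. For each $j$ let $B_j=\{b_{ji}:1\le i\le s\}$, and $S$ contains $W_j=\{w_{j1},\dots,w_{j(s-\beta'_j)}\}$ and $X_j=\{x_{j1},\dots,x_{j(\beta'_j-\beta_j)}\}$. Edges: each node of $A_i\cup A'_i$ is joined to each $b_{ji}\in Bset_i$ with weight $\delta(a_i,b_j)$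 (the main edges); each node of $W_j$ is joined to each node of $B_j$ with weight $0$; each node of $X_j$ is joined to each node of $B_j$ with weight $\gamma'$. A set $Y$ with $|Y|=|\sum_i\alpha'_i-\sum_j\beta_j|$ is added: if $\sum_i\alpha'_i<\sum_j\beta_j$, $Y\subseteq S$ and each node of each $Bset_i$ is joined to each node of $Y$ with weight $0$; if $\sum_i\alpha'_i>\sum_j\beta_j$, $Y\subseteq T$, each node of each $X_j$ is joined to each node of $Y$ with weight $\gamma''$, and each node of each $A'_i$ is joined to each node of $Y$ with weight $0$; if the sums are equal, $Y=\emptyset$. -}

module Defs where

open import Data.Nat using (ℕ; _∸_) renaming (_≤_ to _≤ℕ_)
open import Data.Fin using (Fin; _≟_)
open import Data.List using (List; []; _∷_; _++_; map; concatMap; foldr; allFin)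
open import Data.Nat.ListAction using (sum)
open import Data.Bool using (Bool; true; false; if_then_else_)
open import Data.Product using (_×_; _,_)
open import Relation.Nullary using (does; ¬_)
open import Relation.Binary.PropositionalEquality using (_≡_; _≢_)
open import Relation.Binary.Structures using (IsTotalOrder)
open import Algebra.Structures using (IsAbelianGroup)
open import Function.Bundles using (_⤖_; Bijection)

-- Costs.  The paper uses real costs; the standard library has no reals,
-- so costs live in an arbitrary totally ordered abelian group (of which
-- (ℝ, +, ≤) is an instance).

record OrdAbGroup : Set₁ where
  infixl 6 _+_
  infix 4 _≤_ _<_
  field
    Carrier        : Set
    _+_            : Carrier → Carrier → Carrier
    0#             : Carrier
    -_             : Carrier → Carrier
    _≤_            : Carrier → Carrier → Set
    isAbelianGroup : IsAbelianGroup _≡_ _+_ 0# -_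
    isTotalOrder   : IsTotalOrder _≡_ _≤_
    +-mono-≤       : ∀ z {x y} → x ≤ y → x + z ≤ y + z

  _<_ : Carrier → Carrier → Set
  x < y = (x ≤ y) × (x ≢ y)

  Σ⁺ : List Carrier → Carrier
  Σ⁺ = foldr _+_ 0#

record Data (G : OrdAbGroup) : Set where
  open OrdAbGroup G
  field
    s t  : ℕ
    δ    : Fin s → Fin t → Carrier
    α α' : Fin s → ℕ
    β β' : Fin t → ℕ
    γ' γ'' : Carrier

module Construction (G : OrdAbGroup) (D : Data G) where
  open OrdAbGroup G
  open Data D

  sumℕ : List ℕ → ℕ
  sumℕ = sum

  ΣA' : ℕ
  ΣA' = sumℕ (map α' (allFin s))

  ΣB : ℕ
  ΣB = sumℕ (map β (allFin t))

  -- MMDC matchings.  A set L ⊆ A × B is given by its indicator.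

  PairSet : Set
  PairSet = Fin s → Fin t → Bool

  ind : Bool → ℕ
  ind true  = 1
  ind false = 0

  degA : PairSet → Fin s → ℕ
  degA L i = sumℕ (map (λ j → ind (L i j)) (allFin t))

  degB : PairSet → Fin t → ℕ
  degB L j = sumℕ (map (λ i → ind (L i j)) (allFin s))

  cost : PairSet → Carrier
  cost L = Σ⁺ (concatMap (λ i → map (λ j → if L i j then δ i j else 0#) (allFin t)) (allFin s))

  Feasible : PairSet → Set
  Feasible L = (∀ i → (α i ≤ℕ degA L i) × (degA L i ≤ℕ α' i))
             × (∀ j → (β j ≤ℕ degB L j) × (degB L j ≤ℕ β' j))

  IsMMDC : PairSet → Set
  IsMMDC L = Feasible L × (∀ L′ → Feasible L′ → cost L ≤ cost L′)

  data SNode : Set where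
    aN  : (i : Fin s) → Fin (α i) → SNode
    a'N : (i : Fin s) → Fin (α' i ∸ α i) → SNode
    wN  : (j : Fin t) → Fin (s ∸ β' j) → SNode
    xN  : (j : Fin t) → Fin (β' j ∸ β j) → SNode
    yS  : Fin (ΣB ∸ ΣA') → SNode

  data TNode : Set where
    bN : (j : Fin t) → (i : Fin s) → TNode
    yT : Fin (ΣA' ∸ ΣB) → TNode

  -- (Exactly one of yS / yT is inhabited unless the sums are equal,
  --  and |Y| = |Σα' − Σβ|.)

  allS : List SNode
  allS = concatMap (λ i → map (aN i) (allFin (α i)) ++ map (a'N i) (allFin (α' i ∸ α i))) (allFin s)
      ++ concatMap (λ j → map (wN j) (allFin (s ∸ β' j)) ++ map (xN j) (allFin (β' j ∸ β j))) (allFin t)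
      ++ map yS (allFin (ΣB ∸ ΣA'))

  _==_ : ∀ {n} → Fin n → Fin n → Bool
  x == y = does (x ≟ y)

  isEdge : SNode → TNode → Bool
  isEdge (aN i _)  (bN j i′) = i == i′
  isEdge (a'N i _) (bN j i′) = i == i′
  isEdge (a'N i _) (yT _)    = true
  isEdge (wN j _)  (bN j′ i) = j == j′
  isEdge (xN j _)  (bN j′ i) = j == j′
  isEdge (xN j _)  (yT _)    = true
  isEdge (yS _)    (bN j i)  = true
  isEdge _         _         = false

  -- Weight of an edge (only meaningful when isEdge u v ≡ true).
  weight : SNode → TNode → Carrier
  weight (aN i _)  (bN j i′) = δ i j
  weight (a'N i _) (bN j i′) = δ i j
  weight (a'N i _) (yT _)    = 0#
  weight (wN j _)  (bN j′ i) = 0#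
  weight (xN j _)  (bN j′ i) = γ'
  weight (xN j _)  (yT _)    = γ''
  weight (yS _)    (bN j i)  = 0#
  weight _         _         = 0#

  isMain : SNode → TNode → Bool
  isMain (aN i _)  (bN j i′) = i == i′
  isMain (a'N i _) (bN j i′) = i == i′
  isMain _         _         = false

  record PerfectMatching : Set where
    field
      bij     : SNode ⤖ TNode
      inGraph : ∀ u → isEdge u (Bijection.to bij u) ≡ true

    mate : SNode → TNode
    mate = Bijection.to bij

  open PerfectMatching public

  totalWeight : PerfectMatching → Carrier
  totalWeight M = Σ⁺ (map (λ u → weight u (mate M u)) allS)

  IsMinWeightPM : PerfectMatching → Set
  IsMinWeightPM M = ∀ M′ → totalWeight M ≤ totalWeight M′

  mainWeight : PerfectMatching → Carrier
  mainWeight M = Σ⁺ (map (λ u → if isMain u (mate M u) then weight u (mate M u) else 0#) allS)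

module Submission where

-- The inequality holds for every perfect matching M of G.  The main edges
-- of M determine the set L_M of pairs (a_i, b_j) whose copy b_{ji} is matched by a
-- main edge; L_M is feasible and c(L_M) = w(main edges of M), so minimality of L
-- gives c(L) ≤ w(M).
--
-- Feasibility is double counting.  Sums over lists in a commutative monoid are
-- reindexed along the matching, a bijection S ⤖ T, using duplicate-free complete
-- enumerations of S and T.  A degree of L_M is a sum over T; moved to S it is bounded
-- node by node by the edges of G (a node of A_i is adjacent only to Bset_i, a node of
-- W_j only to B_j, …), and the bounds sum to the class sizes α_i, α'_i, s ∸ β'_j,
-- s ∸ β_j.  The part Y of S is empty since L is feasible (Σβ ≤ |L| ≤ Σα').

open import Defs
open import Level using (Level; 0ℓ)
open import Algebra.Bundles using (CommutativeMonoid)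
open import Algebra.Structures using (IsAbelianGroup)
open import Function using (_∘_)
open import Function.Bundles using (_⤖_; Bijection; Inverse; mk⇔)
open import Function.Properties.Bijection using (⤖⇒↔)
open import Relation.Binary.PropositionalEquality as ≡ using (_≡_; _≢_; cong; cong₂)
open import Relation.Nullary using (does; ¬_; yes; no)
open import Relation.Nullary.Decidable using (dec-true)
open import Data.Empty using (⊥-elim)
open import Data.Bool using (Bool; true; false; if_then_else_)
open import Data.Product using (_×_; _,_; proj₁; proj₂)
open import Data.Sum using ([_,_]′)
open import Data.Nat as ℕ using (ℕ; _+_; _*_; _∸_; _≤_)
import Data.Nat.Properties as ℕₚ
open import Data.Fin using (Fin; zero; suc; _≟_; toℕ)
open import Data.Fin.Properties using (toℕ-injective; ¬Fin0)
open import Data.List using (List; []; _∷_; _++_; map; concat; concatMap; foldr; allFin; tabulate; length)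
open import Data.List.Membership.Propositional using (_∈_)
open import Data.List.Membership.Propositional.Properties using (∈-map⁺; ∈-++⁺ˡ; ∈-++⁺ʳ; ∈-++⁻; ∈-concat⁺′; ∈-allFin)
open import Data.List.Membership.Propositional.Properties.WithK using (unique∧set⇒bag)
open import Data.List.Properties using (map-∘; map-++; map-cong; map-tabulate; concat-map; length-tabulate)
open import Data.List.Relation.Binary.BagAndSetEquality using (∼bag⇒↭)
open import Data.List.Relation.Binary.Disjoint.Propositional using (Disjoint)
open import Data.List.Relation.Binary.Permutation.Propositional using (_↭_; ↭⇒↭ₛ′)
import Data.List.Relation.Binary.Permutation.Propositional.Properties as ↭
import Data.List.Relation.Binary.Permutation.Setoid.Properties as ↭ₛ
open import Data.List.Relation.Unary.All as All using (All)
import Data.List.Relation.Unary.All.Properties as AllP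
import Data.List.Relation.Unary.AllPairs as AllPairs
import Data.List.Relation.Unary.AllPairs.Properties as AllPairsP
open import Data.List.Relation.Unary.Unique.Propositional using (Unique)
import Data.List.Relation.Unary.Unique.Propositional.Properties as Unique

module ListSum {c ℓ} (M : CommutativeMonoid c ℓ) where
  open CommutativeMonoid M renaming (Carrier to C)
  open import Relation.Binary.Reasoning.Setoid setoid

  private variable
    ℓ₁ ℓ₂ : Level
    A : Set ℓ₁
    B : Set ℓ₂

  Σ : List C → C
  Σ = foldr _∙_ ε

  ∑ : List A → (A → C) → C
  ∑ xs f = Σ (map f xs)

  Σ-++ : ∀ xs ys → Σ (xs ++ ys) ≈ Σ xs ∙ Σ ys
  Σ-++ []       ys = sym (identityˡ _)
  Σ-++ (x ∷ xs) ys = begin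
    x ∙ Σ (xs ++ ys)      ≈⟨ ∙-congˡ (Σ-++ xs ys) ⟩
    x ∙ (Σ xs ∙ Σ ys)     ≈⟨ assoc x _ _ ⟨
    (x ∙ Σ xs) ∙ Σ ys     ∎

  Σ-concat : ∀ xss → Σ (concat xss) ≈ ∑ xss Σ
  Σ-concat []         = refl
  Σ-concat (xs ∷ xss) = trans (Σ-++ xs (concat xss)) (∙-congˡ (Σ-concat xss))

  ∑-cong : {f g : A → C} → (∀ x → f x ≈ g x) → ∀ xs → ∑ xs f ≈ ∑ xs g
  ∑-cong f≈g []       = refl
  ∑-cong f≈g (x ∷ xs) = ∙-cong (f≈g x) (∑-cong f≈g xs)

  ∑-map : ∀ (f : B → C) (g : A → B) xs → ∑ (map g xs) f ≡ ∑ xs (f ∘ g)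
  ∑-map f g xs = cong Σ (≡.sym (map-∘ xs))

  ∑-++ : ∀ (f : A → C) xs ys → ∑ (xs ++ ys) f ≈ ∑ xs f ∙ ∑ ys f
  ∑-++ f xs ys = begin
    Σ (map f (xs ++ ys))         ≡⟨ cong Σ (map-++ f xs ys) ⟩
    Σ (map f xs ++ map f ys)     ≈⟨ Σ-++ (map f xs) (map f ys) ⟩
    ∑ xs f ∙ ∑ ys f              ∎

  ∑-concatMap : ∀ (f : B → C) (g : A → List B) xs →
                ∑ (concatMap g xs) f ≈ ∑ xs (λ x → ∑ (g x) f)
  ∑-concatMap f g xs = begin
    Σ (map f (concat (map g xs)))          ≡⟨ cong Σ (concat-map (map g xs)) ⟨
    Σ (concat (map (map f) (map g xs)))    ≈⟨ Σ-concat (map (map f) (map g xs)) ⟩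
    ∑ (map (map f) (map g xs)) Σ           ≡⟨ ∑-map Σ (map f) (map g xs) ⟩
    ∑ (map g xs) (λ ys → ∑ ys f)           ≡⟨ ∑-map (λ ys → ∑ ys f) g xs ⟩
    ∑ xs (λ x → ∑ (g x) f)                 ∎

  ∑-ε : {f : A → C} → (∀ x → f x ≈ ε) → ∀ xs → ∑ xs f ≈ ε
  ∑-ε f≈ε []       = refl
  ∑-ε f≈ε (x ∷ xs) = trans (∙-cong (f≈ε x) (∑-ε f≈ε xs)) (identityˡ ε)

  ∑-∙ : ∀ (f g : A → C) xs → ∑ xs (λ x → f x ∙ g x) ≈ ∑ xs f ∙ ∑ xs g
  ∑-∙ f g []       = sym (identityˡ ε)
  ∑-∙ f g (x ∷ xs) = begin
    (f x ∙ g x) ∙ ∑ xs (λ x → f x ∙ g x)   ≈⟨ ∙-congˡ (∑-∙ f g xs) ⟩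
    (f x ∙ g x) ∙ (∑ xs f ∙ ∑ xs g)         ≈⟨ interchange (f x) (g x) _ _ ⟩
    (f x ∙ ∑ xs f) ∙ (g x ∙ ∑ xs g)         ∎
    where open import Algebra.Properties.CommutativeSemigroup commutativeSemigroup using (interchange)

  ∑-swap : ∀ (h : A → B → C) xs ys →
           ∑ xs (λ x → ∑ ys (h x)) ≈ ∑ ys (λ y → ∑ xs (λ x → h x y))
  ∑-swap h xs []       = ∑-ε (λ _ → refl) xs
  ∑-swap h xs (y ∷ ys) = trans (∑-∙ (λ x → h x y) (λ x → ∑ ys (h x)) xs)
                               (∙-congˡ (∑-swap h xs ys))

  ∑-↭ : ∀ (f : A → C) {xs ys} → xs ↭ ys → ∑ xs f ≈ ∑ ys f
  ∑-↭ f p = ↭ₛ.foldr-commMonoid setoid isCommutativeMonoid (↭⇒↭ₛ′ isEquivalence (↭.map⁺ f p))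

  ∑-if : ∀ b (f : A → C) xs → ∑ xs (λ x → if b then f x else ε) ≈ (if b then ∑ xs f else ε)
  ∑-if true  f xs = refl
  ∑-if false f xs = ∑-ε (λ _ → refl) xs

  ∑-select : ∀ n (k₀ : Fin n) (f : Fin n → C) →
             ∑ (allFin n) (λ k → if does (k ≟ k₀) then f k else ε) ≈ f k₀
  ∑-select n k₀ f = begin
    ∑ (allFin n) guarded          ≡⟨ cong Σ (map-tabulate (λ k → k) guarded) ⟩
    Σ (tabulate guarded)          ≈⟨ select n k₀ f ⟩
    f k₀                          ∎
    where
    guarded : Fin n → C
    guarded k = if does (k ≟ k₀) then f k else ε

    select : ∀ m (k₀ : Fin m) (f : Fin m → C) →
             Σ (tabulate (λ k → if does (k ≟ k₀) then f k else ε)) ≈ f k₀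
    select (ℕ.suc m) zero     f = trans (∙-congˡ (Σ-zeros m)) (identityʳ (f zero))
      where
      Σ-zeros : ∀ m → Σ (tabulate {n = m} (λ _ → ε)) ≈ ε
      Σ-zeros ℕ.zero    = refl
      Σ-zeros (ℕ.suc m) = trans (∙-congˡ (Σ-zeros m)) (identityˡ ε)
    select (ℕ.suc m) (suc k₀) f = trans (identityˡ _) (select m k₀ (f ∘ suc))

module ℕSum where
  open ListSum ℕₚ.+-0-commutativeMonoid public

  ∑-mono : ∀ {A : Set} {f g : A → ℕ} → (∀ x → f x ≤ g x) → ∀ xs → ∑ xs f ≤ ∑ xs g
  ∑-mono f≤g []       = ℕ.z≤n
  ∑-mono f≤g (x ∷ xs) = ℕₚ.+-mono-≤ (f≤g x) (∑-mono f≤g xs)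

  ∑-const : ∀ n c → ∑ (allFin n) (λ _ → c) ≡ n * c
  ∑-const n c = ≡.trans (∑-const-length (allFin n)) (cong (_* c) (length-tabulate {n = n} (λ k → k)))
    where
    ∑-const-length : ∀ {A : Set} (xs : List A) → ∑ xs (λ _ → c) ≡ length xs * c
    ∑-const-length []       = ≡.refl
    ∑-const-length (x ∷ xs) = cong (c +_) (∑-const-length xs)

  point : ∀ {n} → Fin n → Fin n → ℕ
  point k₀ k = if does (k ≟ k₀) then 1 else 0

  ∑-point : ∀ n (k₀ : Fin n) (f : Fin n → ℕ) → ∑ (allFin n) (λ k → f k * point k₀ k) ≡ f k₀
  ∑-point n k₀ f = ≡.trans (∑-cong (λ k → *-if (does (k ≟ k₀)) (f k)) (allFin n)) (∑-select n k₀ f)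
    where
    *-if : ∀ b m → m * (if b then 1 else 0) ≡ (if b then m else 0)
    *-if true  m = ℕₚ.*-identityʳ m
    *-if false m = ℕₚ.*-zeroʳ m

between : ∀ {n b b′ d r} → b ≤ b′ → b′ ≤ n → d + r ≡ n →
          n ∸ b′ ≤ r → r ≤ (n ∸ b′) + (b′ ∸ b) → b ≤ d × d ≤ b′
between {n} {b} {b′} {d} {r} b≤b′ b′≤n d+r≡n lower upper = b≤d , d≤b′
  where
  open ℕₚ.≤-Reasoning
  b≤d : b ≤ d
  b≤d = ℕₚ.+-cancelʳ-≤ r b d (begin
    b + r                            ≤⟨ ℕₚ.+-monoʳ-≤ b upper ⟩
    b + ((n ∸ b′) + (b′ ∸ b))        ≡⟨ cong (b +_) (ℕₚ.+-comm (n ∸ b′) (b′ ∸ b)) ⟩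
    b + ((b′ ∸ b) + (n ∸ b′))        ≡⟨ ℕₚ.+-assoc b (b′ ∸ b) (n ∸ b′) ⟨
    (b + (b′ ∸ b)) + (n ∸ b′)        ≡⟨ cong (_+ (n ∸ b′)) (ℕₚ.m+[n∸m]≡n b≤b′) ⟩
    b′ + (n ∸ b′)                    ≡⟨ ℕₚ.m+[n∸m]≡n b′≤n ⟩
    n                                ≡⟨ d+r≡n ⟨
    d + r                            ∎)
  d≤b′ : d ≤ b′
  d≤b′ = ℕₚ.+-cancelˡ-≤ (n ∸ b′) d b′ (begin
    (n ∸ b′) + d                     ≡⟨ ℕₚ.+-comm (n ∸ b′) d ⟩
    d + (n ∸ b′)                     ≤⟨ ℕₚ.+-monoʳ-≤ d lower ⟩
    d + r                            ≡⟨ d+r≡n ⟩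
    n                                ≡⟨ ℕₚ.m∸n+n≡m b′≤n ⟨
    (n ∸ b′) + b′                    ∎)

record IsEnumeration {A : Set} (xs : List A) : Set where
  field
    unique   : Unique xs
    complete : ∀ x → x ∈ xs

module Reindex {A B : Set} (σ : A ⤖ B) {xs : List A} {ys : List B}
               (xs-enum : IsEnumeration xs) (ys-enum : IsEnumeration ys) where
  open Inverse (⤖⇒↔ σ) using (to; from; strictlyInverseˡ; strictlyInverseʳ)

  map-↭ : map to xs ↭ ys
  map-↭ = ∼bag⇒↭ (unique∧set⇒bag (Unique.map⁺ (Bijection.injective σ) (IsEnumeration.unique xs-enum))
                                  (IsEnumeration.unique ys-enum)
                                  (mk⇔ (λ _ → IsEnumeration.complete ys-enum _) image))
    where
    image : ∀ {y} → y ∈ ys → y ∈ map to xs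
    image {y} _ = ≡.subst (_∈ map to xs) (strictlyInverseˡ y)
                          (∈-map⁺ to (IsEnumeration.complete xs-enum (from y)))

  ∑-reindex : ∀ {c ℓ} (M : CommutativeMonoid c ℓ) (let open CommutativeMonoid M) (let open ListSum M)
              (F : A → B → Carrier) → ∑ xs (λ x → F x (to x)) ≈ ∑ ys (λ y → F (from y) y)
  ∑-reindex M F = begin
    ∑ xs (λ x → F x (to x))                ≡⟨ cong Σ (map-cong (λ x → cong (λ z → F z (to x)) (≡.sym (strictlyInverseʳ x))) xs) ⟩
    ∑ xs (λ x → F (from (to x)) (to x))    ≡⟨ ∑-map (λ y → F (from y) y) to xs ⟨
    ∑ (map to xs) (λ y → F (from y) y)     ≈⟨ ∑-↭ (λ y → F (from y) y) map-↭ ⟩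
    ∑ ys (λ y → F (from y) y)              ∎
    where
    open CommutativeMonoid M
    open ListSum M
    open import Relation.Binary.Reasoning.Setoid setoid

unique-concatMap : ∀ {A B : Set} {f : A → List B} {xs : List A} → Unique xs →
                   (∀ x → Unique (f x)) → (∀ {x y} → x ≢ y → Disjoint (f x) (f y)) →
                   Unique (concatMap f xs)
unique-concatMap {xs = xs} xs! f! disjoint =
  Unique.concat⁺ (AllP.map⁺ (All.universal f! xs)) (AllPairsP.map⁺ (AllPairs.map disjoint xs!))

∈-concatMap : ∀ {A B : Set} (f : A → List B) {y x xs} → y ∈ f x → x ∈ xs → y ∈ concatMap f xs
∈-concatMap f y∈fx x∈xs = ∈-concat⁺′ y∈fx (∈-map⁺ f x∈xs)

unique-image : ∀ {A : Set} {n} (g : Fin n → A) → (∀ {k k′} → g k ≡ g k′ → k ≡ k′) → Unique (map g (allFin n))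
unique-image g g-injective = Unique.map⁺ g-injective (Unique.allFin⁺ _)

labelled : ∀ {A K : Set} {n} (label : A → K) {ℓ : K} (g : Fin n → A) →
           (∀ k → label (g k) ≡ ℓ) → All (λ z → label z ≡ ℓ) (map g (allFin n))
labelled label g labelled-g = AllP.map⁺ (All.universal labelled-g (allFin _))

disjoint-by : ∀ {A K : Set} (label : A → K) {k k′ : K} {xs ys : List A} →
              All (λ z → label z ≡ k) xs → All (λ z → label z ≡ k′) ys → k ≢ k′ → Disjoint xs ys
disjoint-by label xs-k ys-k′ k≢k′ (z∈xs , z∈ys) =
  k≢k′ (≡.trans (≡.sym (All.lookup xs-k z∈xs)) (All.lookup ys-k′ z∈ys))

disjoint-++ : ∀ {A : Set} {xs ys zs : List A} → Disjoint xs ys → Disjoint xs zs → Disjoint xs (ys ++ zs)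
disjoint-++ {ys = ys} xs#ys xs#zs (z∈xs , z∈ys++zs) =
  [ (λ z∈ys → xs#ys (z∈xs , z∈ys)) , (λ z∈zs → xs#zs (z∈xs , z∈zs)) ]′ (∈-++⁻ ys z∈ys++zs)

module Graph (G : OrdAbGroup) (D : Data G) where
  open Data D
  open Construction G D

  aBlock : Fin s → List SNode
  aBlock i = map (aN i) (allFin (α i)) ++ map (a'N i) (allFin (α' i ∸ α i))

  bBlock : Fin t → List SNode
  bBlock j = map (wN j) (allFin (s ∸ β' j)) ++ map (xN j) (allFin (β' j ∸ β j))

  column : Fin s → List TNode
  column i = map (λ j → bN j i) (allFin t)

  allT : List TNode
  allT = concatMap column (allFin s) ++ map yT (allFin (ΣA' ∸ ΣB))

  -- Labels separating the blocks of S: the family (copies of A, dummies of B, Y),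
  -- the index of the point owning the node, and whether the node is optional.
  family : SNode → ℕ
  family (aN _ _)  = 0
  family (a'N _ _) = 0
  family (wN _ _)  = 1
  family (xN _ _)  = 1
  family (yS _)    = 2

  owner : SNode → ℕ
  owner (aN i _)  = toℕ i
  owner (a'N i _) = toℕ i
  owner (wN j _)  = toℕ j
  owner (xN j _)  = toℕ j
  owner (yS _)    = 0

  optional : SNode → Bool
  optional (a'N _ _) = true
  optional (xN _ _)  = true
  optional _         = false

  aBlock-labels : ∀ i → All (λ u → family u ≡ 0) (aBlock i) × All (λ u → owner u ≡ toℕ i) (aBlock i)
  aBlock-labels i = AllP.++⁺ (labelled family (aN i) (λ _ → ≡.refl)) (labelled family (a'N i) (λ _ → ≡.refl))
                  , AllP.++⁺ (labelled owner (aN i) (λ _ → ≡.refl)) (labelled owner (a'N i) (λ _ → ≡.refl))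

  bBlock-labels : ∀ j → All (λ u → family u ≡ 1) (bBlock j) × All (λ u → owner u ≡ toℕ j) (bBlock j)
  bBlock-labels j = AllP.++⁺ (labelled family (wN j) (λ _ → ≡.refl)) (labelled family (xN j) (λ _ → ≡.refl))
                  , AllP.++⁺ (labelled owner (wN j) (λ _ → ≡.refl)) (labelled owner (xN j) (λ _ → ≡.refl))

  aBlock-unique : ∀ i → Unique (aBlock i)
  aBlock-unique i = Unique.++⁺ (unique-image (aN i) λ { ≡.refl → ≡.refl })
                               (unique-image (a'N i) λ { ≡.refl → ≡.refl })
                               (disjoint-by optional (labelled optional (aN i) (λ _ → ≡.refl))
                                                     (labelled optional (a'N i) (λ _ → ≡.refl)) (λ ()))

  bBlock-unique : ∀ j → Unique (bBlock j)
  bBlock-unique j = Unique.++⁺ (unique-image (wN j) λ { ≡.refl → ≡.refl })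
                               (unique-image (xN j) λ { ≡.refl → ≡.refl })
                               (disjoint-by optional (labelled optional (wN j) (λ _ → ≡.refl))
                                                     (labelled optional (xN j) (λ _ → ≡.refl)) (λ ()))

  copies dummies : List SNode
  copies  = concatMap aBlock (allFin s)
  dummies = concatMap bBlock (allFin t)

  allS-unique : Unique allS
  allS-unique = Unique.++⁺ A! (Unique.++⁺ B! Y! (disjoint-by family B-family Y-family λ ()))
                           (disjoint-++ (disjoint-by family A-family B-family λ ())
                                        (disjoint-by family A-family Y-family λ ()))
    where
    A! = unique-concatMap (Unique.allFin⁺ s) aBlock-unique
           (λ i≢i′ → disjoint-by owner (proj₂ (aBlock-labels _)) (proj₂ (aBlock-labels _)) (i≢i′ ∘ toℕ-injective))
    B! = unique-concatMap (Unique.allFin⁺ t) bBlock-unique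
           (λ j≢j′ → disjoint-by owner (proj₂ (bBlock-labels _)) (proj₂ (bBlock-labels _)) (j≢j′ ∘ toℕ-injective))
    Y! = unique-image yS λ { ≡.refl → ≡.refl }
    A-family = AllP.concat⁺ (AllP.map⁺ (All.universal (proj₁ ∘ aBlock-labels) (allFin s)))
    B-family = AllP.concat⁺ (AllP.map⁺ (All.universal (proj₁ ∘ bBlock-labels) (allFin t)))
    Y-family = labelled family yS (λ _ → ≡.refl)

  allS-complete : ∀ u → u ∈ allS
  allS-complete (aN i k)  = ∈-++⁺ˡ (∈-concatMap aBlock (∈-++⁺ˡ (∈-map⁺ (aN i) (∈-allFin k))) (∈-allFin i))
  allS-complete (a'N i k) = ∈-++⁺ˡ (∈-concatMap aBlock (∈-++⁺ʳ _ (∈-map⁺ (a'N i) (∈-allFin k))) (∈-allFin i))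
  allS-complete (wN j k)  = ∈-++⁺ʳ copies (∈-++⁺ˡ (∈-concatMap bBlock (∈-++⁺ˡ (∈-map⁺ (wN j) (∈-allFin k))) (∈-allFin j)))
  allS-complete (xN j k)  = ∈-++⁺ʳ copies (∈-++⁺ˡ (∈-concatMap bBlock (∈-++⁺ʳ _ (∈-map⁺ (xN j) (∈-allFin k))) (∈-allFin j)))
  allS-complete (yS k)    = ∈-++⁺ʳ copies (∈-++⁺ʳ dummies (∈-map⁺ yS (∈-allFin k)))

  allT-unique : Unique allT
  allT-unique = Unique.++⁺ columns! (unique-image yT λ { ≡.refl → ≡.refl })
                           (disjoint-by isY (AllP.concat⁺ (AllP.map⁺ (All.universal column-isY (allFin s))))
                                            (labelled isY yT (λ _ → ≡.refl)) λ ())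
    where
    isY : TNode → Bool
    isY (bN _ _) = false
    isY (yT _)   = true

    index : TNode → ℕ
    index (bN _ i) = toℕ i
    index (yT _)   = 0

    column-isY : ∀ i → All (λ v → isY v ≡ false) (column i)
    column-isY i = labelled isY (λ j → bN j i) (λ _ → ≡.refl)

    columns! = unique-concatMap (Unique.allFin⁺ s) (λ i → unique-image (λ j → bN j i) λ { ≡.refl → ≡.refl })
                 (λ i≢i′ → disjoint-by index (labelled index (λ j → bN j _) (λ _ → ≡.refl))
                                             (labelled index (λ j → bN j _) (λ _ → ≡.refl)) (i≢i′ ∘ toℕ-injective))

  allT-complete : ∀ v → v ∈ allT
  allT-complete (bN j i) = ∈-++⁺ˡ (∈-concatMap column (∈-map⁺ (λ j → bN j i) (∈-allFin j)) (∈-allFin i))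
  allT-complete (yT k)   = ∈-++⁺ʳ _ (∈-map⁺ yT (∈-allFin k))

  S-enumeration : IsEnumeration allS
  S-enumeration = record { unique = allS-unique ; complete = allS-complete }

  T-enumeration : IsEnumeration allT
  T-enumeration = record { unique = allT-unique ; complete = allT-complete }

  module SideSums {c ℓ} (M : CommutativeMonoid c ℓ) where
    open CommutativeMonoid M renaming (Carrier to C)
    open ListSum M
    open import Relation.Binary.Reasoning.Setoid setoid

    ∑-allS : (f : SNode → C) → ∑ allS f ≈
             ∑ (allFin s) (λ i → ∑ (allFin (α i)) (f ∘ aN i) ∙ ∑ (allFin (α' i ∸ α i)) (f ∘ a'N i))
             ∙ (∑ (allFin t) (λ j → ∑ (allFin (s ∸ β' j)) (f ∘ wN j) ∙ ∑ (allFin (β' j ∸ β j)) (f ∘ xN j))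
                ∙ ∑ (allFin (ΣB ∸ ΣA')) (f ∘ yS))
    ∑-allS f = begin
      ∑ allS f                                   ≈⟨ ∑-++ f copies (dummies ++ Y) ⟩
      ∑ copies f ∙ ∑ (dummies ++ Y) f            ≈⟨ ∙-cong (∑-concatMap f aBlock (allFin s)) (∑-++ f dummies Y) ⟩
      ∑ (allFin s) (λ i → ∑ (aBlock i) f) ∙ (∑ dummies f ∙ ∑ Y f)
        ≈⟨ ∙-cong (∑-cong (λ i → block (aN i) (a'N i)) (allFin s))
                  (∙-cong (trans (∑-concatMap f bBlock (allFin t)) (∑-cong (λ j → block (wN j) (xN j)) (allFin t)))
                          (reflexive (∑-map f yS (allFin _)))) ⟩
      _                                          ∎
      where
      Y = map yS (allFin (ΣB ∸ ΣA'))
      block : ∀ {m n} (g : Fin m → SNode) (h : Fin n → SNode) →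
              ∑ (map g (allFin m) ++ map h (allFin n)) f ≈ ∑ (allFin m) (f ∘ g) ∙ ∑ (allFin n) (f ∘ h)
      block {m} {n} g h = trans (∑-++ f (map g (allFin m)) (map h (allFin n)))
                                 (∙-cong (reflexive (∑-map f g (allFin m))) (reflexive (∑-map f h (allFin n))))

    ∑-allT : (f : TNode → C) → (∀ k → f (yT k) ≈ ε) →
             ∑ allT f ≈ ∑ (allFin s) (λ i → ∑ (allFin t) (λ j → f (bN j i)))
    ∑-allT f f-Y≈ε = begin
      ∑ allT f                                                   ≈⟨ ∑-++ f (concatMap column (allFin s)) Y ⟩
      ∑ (concatMap column (allFin s)) f ∙ ∑ Y f                  ≈⟨ ∙-cong (∑-concatMap f column (allFin s)) (trans (reflexive (∑-map f yT (allFin _))) (∑-ε f-Y≈ε (allFin _))) ⟩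
      ∑ (allFin s) (λ i → ∑ (column i) f) ∙ ε                    ≈⟨ identityʳ _ ⟩
      ∑ (allFin s) (λ i → ∑ (column i) f)                        ≈⟨ ∑-cong (λ i → reflexive (∑-map f (λ j → bN j i) (allFin t))) (allFin s) ⟩
      ∑ (allFin s) (λ i → ∑ (allFin t) (λ j → f (bN j i)))       ∎
      where
      Y = map yT (allFin (ΣA' ∸ ΣB))

  open ℕSum

  byClass : (a a′ : Fin s → ℕ) (w x : Fin t → ℕ) → SNode → ℕ
  byClass a a′ w x (aN i _)  = a i
  byClass a a′ w x (a'N i _) = a′ i
  byClass a a′ w x (wN j _)  = w j
  byClass a a′ w x (xN j _)  = x j
  byClass a a′ w x (yS _)    = 0

  ∑-byClass : ∀ a a′ w x → ∑ allS (byClass a a′ w x) ≡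
              ∑ (allFin s) (λ i → α i * a i + (α' i ∸ α i) * a′ i)
              + ∑ (allFin t) (λ j → (s ∸ β' j) * w j + (β' j ∸ β j) * x j)
  ∑-byClass a a′ w x = begin
    ∑ allS (byClass a a′ w x)
      ≡⟨ SideSums.∑-allS ℕₚ.+-0-commutativeMonoid (byClass a a′ w x) ⟩
    ∑ (allFin s) (λ i → ∑ (allFin (α i)) (λ _ → a i) + ∑ (allFin (α' i ∸ α i)) (λ _ → a′ i))
      + (∑ (allFin t) (λ j → ∑ (allFin (s ∸ β' j)) (λ _ → w j) + ∑ (allFin (β' j ∸ β j)) (λ _ → x j))
         + ∑ (allFin (ΣB ∸ ΣA')) (λ _ → 0))
      ≡⟨ cong₂ _+_ (∑-cong (λ i → cong₂ _+_ (∑-const (α i) (a i)) (∑-const (α' i ∸ α i) (a′ i))) (allFin s))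
                   (≡.trans (cong₂ _+_ (∑-cong (λ j → cong₂ _+_ (∑-const (s ∸ β' j) (w j)) (∑-const (β' j ∸ β j) (x j))) (allFin t))
                                       (∑-ε (λ _ → ≡.refl) (allFin (ΣB ∸ ΣA'))))
                            (ℕₚ.+-identityʳ _)) ⟩
    ∑ (allFin s) (λ i → α i * a i + (α' i ∸ α i) * a′ i)
      + ∑ (allFin t) (λ j → (s ∸ β' j) * w j + (β' j ∸ β j) * x j)      ∎
    where open ≡.≡-Reasoning

  none : ∀ {n} → Fin n → ℕ
  none _ = 0

  inA inCopies : Fin s → SNode → ℕ
  inA      i = byClass (point i) none none none
  inCopies i = byClass (point i) (point i) none none

  inW inDummies : Fin t → SNode → ℕ
  inW       j = byClass none none (point j) none
  inDummies j = byClass none none (point j) (point j)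

  private
    weights-zero : ∀ n (f g : Fin n → ℕ) → ∑ (allFin n) (λ k → f k * none k + g k * none k) ≡ 0
    weights-zero n f g = ∑-ε (λ k → cong₂ _+_ (ℕₚ.*-zeroʳ (f k)) (ℕₚ.*-zeroʳ (g k))) (allFin n)

    first-weight : ∀ n (k₀ : Fin n) (f g : Fin n → ℕ) → ∑ (allFin n) (λ k → f k * point k₀ k + g k * none k) ≡ f k₀
    first-weight n k₀ f g = ≡.trans (∑-cong (λ k → ≡.trans (cong (f k * point k₀ k +_) (ℕₚ.*-zeroʳ (g k)))
                                                          (ℕₚ.+-identityʳ _)) (allFin n))
                                    (∑-point n k₀ f)

    both-weights : ∀ n (k₀ : Fin n) (f g : Fin n → ℕ) → ∑ (allFin n) (λ k → f k * point k₀ k + g k * point k₀ k) ≡ f k₀ + g k₀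
    both-weights n k₀ f g = ≡.trans (∑-cong (λ k → ≡.sym (ℕₚ.*-distribʳ-+ (point k₀ k) (f k) (g k))) (allFin n))
                                    (∑-point n k₀ (λ k → f k + g k))

    mα : Fin s → ℕ
    mα i = α' i ∸ α i
    w x : Fin t → ℕ
    w j = s ∸ β' j
    x j = β' j ∸ β j

  size-A : ∀ i → ∑ allS (inA i) ≡ α i
  size-A i = ≡.trans (∑-byClass (point i) none none none)
                     (≡.trans (cong₂ _+_ (first-weight s i α mα) (weights-zero t w x)) (ℕₚ.+-identityʳ _))

  size-copies : ∀ i → ∑ allS (inCopies i) ≡ α i + (α' i ∸ α i)
  size-copies i = ≡.trans (∑-byClass (point i) (point i) none none)
                          (≡.trans (cong₂ _+_ (both-weights s i α mα) (weights-zero t w x)) (ℕₚ.+-identityʳ _))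

  size-W : ∀ j → ∑ allS (inW j) ≡ s ∸ β' j
  size-W j = ≡.trans (∑-byClass none none (point j) none)
                     (cong₂ _+_ (weights-zero s α mα) (first-weight t j w x))

  size-dummies : ∀ j → ∑ allS (inDummies j) ≡ (s ∸ β' j) + (β' j ∸ β j)
  size-dummies j = ≡.trans (∑-byClass none none (point j) (point j))
                           (cong₂ _+_ (weights-zero s α mα) (both-weights t j w x))

  -- Counting the pairs of a feasible set by their B-ends and by their A-ends
  -- gives Σβ ≤ |L| ≤ Σα'; hence the part Y of S is empty.
  feasible⇒ΣB≤ΣA' : ∀ L → Feasible L → ΣB ≤ ΣA'
  feasible⇒ΣB≤ΣA' L (A-ok , B-ok) = begin
    ∑ (allFin t) β          ≤⟨ ∑-mono (proj₁ ∘ B-ok) (allFin t) ⟩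
    ∑ (allFin t) (degB L)   ≡⟨ ∑-swap (λ i j → ind (L i j)) (allFin s) (allFin t) ⟨
    ∑ (allFin s) (degA L)   ≤⟨ ∑-mono (proj₂ ∘ A-ok) (allFin s) ⟩
    ∑ (allFin s) α'         ∎
    where open ℕₚ.≤-Reasoning

  feasible⇒no-Y : ∀ L → Feasible L → ¬ Fin (ΣB ∸ ΣA')
  feasible⇒no-Y L L-ok k = ¬Fin0 (≡.subst Fin (ℕₚ.m≤n⇒m∸n≡0 (feasible⇒ΣB≤ΣA' L L-ok)) k)

  inColumn : Fin s → TNode → ℕ
  inColumn i₀ (bN _ i) = point i₀ i
  inColumn i₀ (yT _)   = 0

  inRow : Fin t → TNode → ℕ
  inRow j₀ (bN j _) = point j₀ j
  inRow j₀ (yT _)   = 0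

  mainInColumn : Fin s → SNode → TNode → ℕ
  mainInColumn i₀ u v = if isMain u v then inColumn i₀ v else 0

  mainInRow : Fin t → SNode → TNode → ℕ
  mainInRow j₀ u v = if isMain u v then inRow j₀ v else 0

  dummyInRow : Fin t → SNode → TNode → ℕ
  dummyInRow j₀ (wN _ _) v = inRow j₀ v
  dummyInRow j₀ (xN _ _) v = inRow j₀ v
  dummyInRow j₀ _        v = 0

  private
    ==⇒≡ : ∀ {n} (i j : Fin n) → does (i ≟ j) ≡ true → i ≡ j
    ==⇒≡ i j e with i ≟ j | e
    ... | yes i≡j | _ = i≡j
    ... | no  _   | ()

    ==-refl : ∀ {n} (i : Fin n) → does (i ≟ i) ≡ true
    ==-refl i = dec-true (i ≟ i) ≡.refl

  A-node-main : ∀ i₀ u v → isEdge u v ≡ true → inA i₀ u ≤ mainInColumn i₀ u v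
  A-node-main i₀ (aN i k) (bN j i′) uv with ==⇒≡ i i′ uv
  ... | ≡.refl rewrite ==-refl i = ℕₚ.≤-refl
  A-node-main i₀ (a'N _ _) v uv = ℕ.z≤n
  A-node-main i₀ (wN _ _)  v uv = ℕ.z≤n
  A-node-main i₀ (xN _ _)  v uv = ℕ.z≤n
  A-node-main i₀ (yS _)    v uv = ℕ.z≤n

  main-from-copy : ∀ i₀ u v → isEdge u v ≡ true → mainInColumn i₀ u v ≤ inCopies i₀ u
  main-from-copy i₀ (aN i k) (bN j i′) uv with ==⇒≡ i i′ uv
  ... | ≡.refl rewrite ==-refl i = ℕₚ.≤-refl
  main-from-copy i₀ (a'N i k) (bN j i′) uv with ==⇒≡ i i′ uv
  ... | ≡.refl rewrite ==-refl i = ℕₚ.≤-refl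
  main-from-copy i₀ (a'N _ _) (yT _) uv = ℕ.z≤n
  main-from-copy i₀ (wN _ _)  v uv = ℕ.z≤n
  main-from-copy i₀ (xN _ _)  v uv = ℕ.z≤n
  main-from-copy i₀ (yS _)    v uv = ℕ.z≤n

  row-split : ¬ Fin (ΣB ∸ ΣA') → ∀ j₀ u v → isEdge u v ≡ true →
              inRow j₀ v ≡ mainInRow j₀ u v + dummyInRow j₀ u v
  row-split no-Y j₀ (aN i k) (bN j i′) uv with ==⇒≡ i i′ uv
  ... | ≡.refl rewrite ==-refl i = ≡.sym (ℕₚ.+-identityʳ _)
  row-split no-Y j₀ (a'N i k) (bN j i′) uv with ==⇒≡ i i′ uv
  ... | ≡.refl rewrite ==-refl i = ≡.sym (ℕₚ.+-identityʳ _)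
  row-split no-Y j₀ (a'N _ _) (yT _) uv = ≡.refl
  row-split no-Y j₀ (wN _ _)  v uv = ≡.refl
  row-split no-Y j₀ (xN _ _)  v uv = ≡.refl
  row-split no-Y j₀ (yS k)    v uv = ⊥-elim (no-Y k)

  W-node-in-row : ∀ j₀ u v → isEdge u v ≡ true → inW j₀ u ≤ dummyInRow j₀ u v
  W-node-in-row j₀ (wN j k) (bN j′ i) uv with ==⇒≡ j j′ uv
  ... | ≡.refl = ℕₚ.≤-refl
  W-node-in-row j₀ (aN _ _)  v uv = ℕ.z≤n
  W-node-in-row j₀ (a'N _ _) v uv = ℕ.z≤n
  W-node-in-row j₀ (xN _ _)  v uv = ℕ.z≤n
  W-node-in-row j₀ (yS _)    v uv = ℕ.z≤n

  dummy-in-own-row : ∀ j₀ u v → isEdge u v ≡ true → dummyInRow j₀ u v ≤ inDummies j₀ u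
  dummy-in-own-row j₀ (wN j k) (bN j′ i) uv with ==⇒≡ j j′ uv
  ... | ≡.refl = ℕₚ.≤-refl
  dummy-in-own-row j₀ (xN j k) (bN j′ i) uv with ==⇒≡ j j′ uv
  ... | ≡.refl = ℕₚ.≤-refl
  dummy-in-own-row j₀ (xN _ _)  (yT _) uv = ℕ.z≤n
  dummy-in-own-row j₀ (aN _ _)  v uv = ℕ.z≤n
  dummy-in-own-row j₀ (a'N _ _) v uv = ℕ.z≤n
  dummy-in-own-row j₀ (yS _)    v uv = ℕ.z≤n

  open OrdAbGroup G using (isAbelianGroup; 0#) renaming (Carrier to Cost)

  costMonoid : CommutativeMonoid 0ℓ 0ℓ
  costMonoid = record { isCommutativeMonoid = IsAbelianGroup.isCommutativeMonoid isAbelianGroup }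

  module Costs = ListSum costMonoid

  cost-by-rows : ∀ L → cost L ≡ Costs.∑ (allFin s) (λ i → Costs.∑ (allFin t) (λ j → if L i j then δ i j else 0#))
  cost-by-rows L = ≡.trans (Costs.Σ-concat (map (λ i → map (λ j → if L i j then δ i j else 0#) (allFin t)) (allFin s)))
                           (Costs.∑-map Costs.Σ (λ i → map (λ j → if L i j then δ i j else 0#) (allFin t)) (allFin s))

  mainWeightOf : SNode → TNode → Cost
  mainWeightOf u v = if isMain u v then weight u v else 0#

  mainWeightOf-Y : ∀ u k → mainWeightOf u (yT k) ≡ 0#
  mainWeightOf-Y (aN _ _)  _ = ≡.refl
  mainWeightOf-Y (a'N _ _) _ = ≡.refl
  mainWeightOf-Y (wN _ _)  _ = ≡.refl
  mainWeightOf-Y (xN _ _)  _ = ≡.refl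
  mainWeightOf-Y (yS _)    _ = ≡.refl

  mainWeightOf-column : ∀ u j i → mainWeightOf u (bN j i) ≡ (if isMain u (bN j i) then δ i j else 0#)
  mainWeightOf-column (aN i′ _) j i with i′ ≟ i
  ... | yes ≡.refl = ≡.refl
  ... | no  _      = ≡.refl
  mainWeightOf-column (a'N i′ _) j i with i′ ≟ i
  ... | yes ≡.refl = ≡.refl
  ... | no  _      = ≡.refl
  mainWeightOf-column (wN _ _) j i = ≡.refl
  mainWeightOf-column (xN _ _) j i = ≡.refl
  mainWeightOf-column (yS _)   j i = ≡.refl

  private
    if-constant : ∀ {A : Set} b (x : A) → (if b then x else x) ≡ x
    if-constant true  x = ≡.refl
    if-constant false x = ≡.refl

    guard-swap : ∀ b c → (if b then (if c then 1 else 0) else 0) ≡ (if c then ind b else 0)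
    guard-swap true  true  = ≡.refl
    guard-swap true  false = ≡.refl
    guard-swap false true  = ≡.refl
    guard-swap false false = ≡.refl

  module MainEdges (M : PerfectMatching) where
    open Inverse (⤖⇒↔ (bij M)) using (from)
    open Reindex (bij M) S-enumeration T-enumeration using (∑-reindex)

    mainPairs : PairSet
    mainPairs i j = isMain (from (bN j i)) (bN j i)

    matched : (SNode → TNode → ℕ) → ℕ
    matched F = ∑ allS (λ u → F u (mate M u))

    matched-by-columns : (F : SNode → TNode → ℕ) → (∀ u k → F u (yT k) ≡ 0) →
                         matched F ≡ ∑ (allFin s) (λ i → ∑ (allFin t) (λ j → F (from (bN j i)) (bN j i)))
    matched-by-columns F F-Y≡0 = ≡.trans (∑-reindex ℕₚ.+-0-commutativeMonoid F)
                                        (SideSums.∑-allT ℕₚ.+-0-commutativeMonoid _ (λ k → F-Y≡0 (from (yT k)) k))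

    degA-mainPairs : ∀ i₀ → matched (mainInColumn i₀) ≡ degA mainPairs i₀
    degA-mainPairs i₀ = begin
      matched (mainInColumn i₀)
        ≡⟨ matched-by-columns (mainInColumn i₀) (λ u k → if-constant (isMain u (yT k)) 0) ⟩
      ∑ (allFin s) (λ i → ∑ (allFin t) (λ j → if mainPairs i j then point i₀ i else 0))
        ≡⟨ ∑-cong (λ i → ∑-cong (λ j → guard-swap (mainPairs i j) (does (i ≟ i₀))) (allFin t)) (allFin s) ⟩
      ∑ (allFin s) (λ i → ∑ (allFin t) (λ j → if does (i ≟ i₀) then ind (mainPairs i j) else 0))
        ≡⟨ ∑-cong (λ i → ∑-if (does (i ≟ i₀)) (λ j → ind (mainPairs i j)) (allFin t)) (allFin s) ⟩
      ∑ (allFin s) (λ i → if does (i ≟ i₀) then degA mainPairs i else 0)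
        ≡⟨ ∑-select s i₀ (degA mainPairs) ⟩
      degA mainPairs i₀ ∎
      where open ≡.≡-Reasoning

    degB-mainPairs : ∀ j₀ → matched (mainInRow j₀) ≡ degB mainPairs j₀
    degB-mainPairs j₀ = begin
      matched (mainInRow j₀)
        ≡⟨ matched-by-columns (mainInRow j₀) (λ u k → if-constant (isMain u (yT k)) 0) ⟩
      ∑ (allFin s) (λ i → ∑ (allFin t) (λ j → if mainPairs i j then point j₀ j else 0))
        ≡⟨ ∑-cong (λ i → ∑-cong (λ j → guard-swap (mainPairs i j) (does (j ≟ j₀))) (allFin t)) (allFin s) ⟩
      ∑ (allFin s) (λ i → ∑ (allFin t) (λ j → if does (j ≟ j₀) then ind (mainPairs i j) else 0))
        ≡⟨ ∑-cong (λ i → ∑-select t j₀ (λ j → ind (mainPairs i j))) (allFin s) ⟩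
      degB mainPairs j₀ ∎
      where open ≡.≡-Reasoning

    -- every row B_j has s nodes, each matched once
    row-size : ∀ j₀ → matched (λ _ → inRow j₀) ≡ s
    row-size j₀ = begin
      matched (λ _ → inRow j₀)                        ≡⟨ matched-by-columns (λ _ → inRow j₀) (λ _ _ → ≡.refl) ⟩
      ∑ (allFin s) (λ i → ∑ (allFin t) (point j₀))   ≡⟨ ∑-cong (λ i → ∑-select t j₀ (λ _ → 1)) (allFin s) ⟩
      ∑ (allFin s) (λ _ → 1)                          ≡⟨ ∑-const s 1 ⟩
      s * 1                                           ≡⟨ ℕₚ.*-identityʳ s ⟩
      s                                               ∎
      where open ≡.≡-Reasoning

    matched-mono : ∀ {F F′ : SNode → TNode → ℕ} → (∀ u v → isEdge u v ≡ true → F u v ≤ F′ u v) →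
                   matched F ≤ matched F′
    matched-mono F≤F′ = ∑-mono (λ u → F≤F′ u (mate M u) (inGraph M u)) allS

    mainPairs-degA : (∀ i → α i ≤ α' i) → ∀ i → α i ≤ degA mainPairs i × degA mainPairs i ≤ α' i
    mainPairs-degA α≤α' i = lower , upper
      where
      open ℕₚ.≤-Reasoning
      lower = begin
        α i                      ≡⟨ size-A i ⟨
        ∑ allS (inA i)           ≤⟨ matched-mono (A-node-main i) ⟩
        matched (mainInColumn i) ≡⟨ degA-mainPairs i ⟩
        degA mainPairs i         ∎
      upper = begin
        degA mainPairs i         ≡⟨ degA-mainPairs i ⟨
        matched (mainInColumn i) ≤⟨ matched-mono (main-from-copy i) ⟩
        ∑ allS (inCopies i)      ≡⟨ size-copies i ⟩
        α i + (α' i ∸ α i)       ≡⟨ ℕₚ.m+[n∸m]≡n (α≤α' i) ⟩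
        α' i                     ∎

    -- … and, when Y ⊆ S is empty, every b_j degree in [β_j, β'_j]: of the s nodes of B_j,
    -- those not covered by main edges are matched to W_j ∪ X_j, which covers all of W_j.
    mainPairs-degB : (∀ j → β j ≤ β' j) → (∀ j → β' j ≤ s) → ¬ Fin (ΣB ∸ ΣA') →
                     ∀ j → β j ≤ degB mainPairs j × degB mainPairs j ≤ β' j
    mainPairs-degB β≤β' β'≤s no-Y j = between (β≤β' j) (β'≤s j) split lower upper
      where
      open ℕₚ.≤-Reasoning
      split : degB mainPairs j + matched (dummyInRow j) ≡ s
      split = begin-equality
        degB mainPairs j + matched (dummyInRow j)         ≡⟨ cong (_+ matched (dummyInRow j)) (degB-mainPairs j) ⟨
        matched (mainInRow j) + matched (dummyInRow j)    ≡⟨ ∑-∙ (λ u → mainInRow j u (mate M u)) (λ u → dummyInRow j u (mate M u)) allS ⟨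
        matched (λ u v → mainInRow j u v + dummyInRow j u v)
          ≡⟨ ∑-cong (λ u → row-split no-Y j u (mate M u) (inGraph M u)) allS ⟨
        matched (λ _ → inRow j)                           ≡⟨ row-size j ⟩
        s                                                 ∎
      lower = begin
        s ∸ β' j                  ≡⟨ size-W j ⟨
        ∑ allS (inW j)            ≤⟨ matched-mono (W-node-in-row j) ⟩
        matched (dummyInRow j)    ∎
      upper = begin
        matched (dummyInRow j)    ≤⟨ matched-mono (dummy-in-own-row j) ⟩
        ∑ allS (inDummies j)      ≡⟨ size-dummies j ⟩
        (s ∸ β' j) + (β' j ∸ β j) ∎

    mainPairs-feasible : (∀ i → α i ≤ α' i) → (∀ j → β j ≤ β' j) → (∀ j → β' j ≤ s) →
                         ¬ Fin (ΣB ∸ ΣA') → Feasible mainPairs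
    mainPairs-feasible α≤α' β≤β' β'≤s no-Y = mainPairs-degA α≤α' , mainPairs-degB β≤β' β'≤s no-Y

    mainWeight≡cost : mainWeight M ≡ cost mainPairs
    mainWeight≡cost = begin
      mainWeight M
        ≡⟨ ∑-reindex costMonoid mainWeightOf ⟩
      Costs.∑ allT (λ v → mainWeightOf (from v) v)
        ≡⟨ SideSums.∑-allT costMonoid _ (λ k → mainWeightOf-Y (from (yT k)) k) ⟩
      Costs.∑ (allFin s) (λ i → Costs.∑ (allFin t) (λ j → mainWeightOf (from (bN j i)) (bN j i)))
        ≡⟨ Costs.∑-cong (λ i → Costs.∑-cong (λ j → mainWeightOf-column (from (bN j i)) j i) (allFin t)) (allFin s) ⟩
      Costs.∑ (allFin s) (λ i → Costs.∑ (allFin t) (λ j → if mainPairs i j then δ i j else 0#))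
        ≡⟨ cost-by-rows mainPairs ⟨
      cost mainPairs ∎
      where open ≡.≡-Reasoning

lemma2 : (G : OrdAbGroup) (D : Data G) →
    let open OrdAbGroup G using (_<_) renaming (_≤_ to _≤G_)
        open Data D
        open Construction G D
    in (∀ i → α i ≤ α' i) →
       (∀ j → β j ≤ β' j) →
       (∀ j → β' j ≤ s) →
       γ' < γ'' →
       (∀ i j → γ'' < δ i j) →
       (M : PerfectMatching) → IsMinWeightPM M →
       (L : PairSet) → IsMMDC L →
       cost L ≤G mainWeight M
lemma2 G D α≤α' β≤β' β'≤s _ _ M _ L (L-feasible , L-minimal) =
  ≡.subst (cost L ≤G_) (≡.sym mainWeight≡cost)
          (L-minimal mainPairs (mainPairs-feasible α≤α' β≤β' β'≤s (feasible⇒no-Y L L-feasible)))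
  where
  open OrdAbGroup G using () renaming (_≤_ to _≤G_)
  open Construction G D using (cost; mainWeight)
  open Graph G D using (feasible⇒no-Y)
  open Graph.MainEdges G D M using (mainPairs; mainPairs-feasible; mainWeight≡cost)
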